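{- For any positive integer $r$, there exist arbitrarily large integers $N$ such that $\{1,\ldots,N\}$ has a partition $\{1,\ldots,N\}=A_1\cup\cdots\cup A_r$ with \[\max\{R_2(A_i):1\leq i\leq r\}\leq 2(r-1)!\,N^{1/r}\] and \[\max\{C(A_i):1\leq i\leq r\}\leq r!\,N^{1/r}.\]
   Context: A finite increasing sequence $a_1<\cdots<a_n$ is strictly convex if the sequence of first differences $a_{i+1}-a_i$ is strictly monotone; $C(B)$ denotes the length of the longest strictly convex sequence contained in $B$. For $L\geq 1$, a finite increasing sequence of real numbers $a_1<\cdots<a_n$ is called $L$-regular if there is a positive real number $X$ such that $X\leq a_{i+1}-a_i\leq LX$ for all $i=1,\ldots,n-1$. For a set $B$ of real numbers, $R_L(B)=\max\{|B'|:B'\subseteq B,\ B'\text{ is }L\text{ -regular}\}$. -}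

module Defs where

open import Data.Nat using (ℕ; zero; suc; _+_; _*_; _∸_; _^_; _≤_; _<_; _>_; _!)
open import Data.Fin using (Fin)
open import Data.List using (List; []; _∷_; length)
open import Data.List.Relation.Unary.All using (All)
open import Data.List.Relation.Unary.Linked using (Linked)
open import Data.Product using (Σ; _×_; ∃-syntax)
open import Data.Sum using (_⊎_)
open import Relation.Binary.PropositionalEquality using (_≡_)

Increasing : List ℕ → Set
Increasing = Linked _<_

diffs : List ℕ → List ℕ
diffs []           = []
diffs (x ∷ [])     = []
diffs (x ∷ y ∷ xs) = (y ∸ x) ∷ diffs (y ∷ xs)

StrictlyConvex : List ℕ → Set
StrictlyConvex xs = Increasing xs × (Linked _<_ (diffs xs) ⊎ Linked _>_ (diffs xs))

-- For integer sequences a real X exists iff a positive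
-- integer X exists (take X = least difference).
Regular : ℕ → List ℕ → Set
Regular L xs = Increasing xs × ∃[ X ] (1 ≤ X × All (λ d → X ≤ d × d ≤ L * X) (diffs xs))

-- The part A_i of {1,…,N} determined by a colouring c : ℕ → Fin r.
InPart : ∀ {r} → ℕ → (ℕ → Fin r) → Fin r → ℕ → Set
InPart N c i a = 1 ≤ a × a ≤ N × c a ≡ i

SubPart : ∀ {r} → ℕ → (ℕ → Fin r) → Fin r → List ℕ → Set
SubPart N c i xs = All (InPart N c i) xs

module Submission where

-- Let m = M + 1 and N = m ^ r.  At level k < r − 1 cut ℕ into blocks of length m ^ (k + 1),
-- and for a colour j group the blocks into windows of r consecutive blocks, shifted by j.
-- At each level exactly one colour sees x in the last block of its window; as there are
-- r − 1 levels and r colours, some colour avoids this at every level, and x receives it.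
-- Inside one colour class a chain of gaps ≤ m ^ (k + 1) cannot jump over a last block, so it
-- stays in one window and spans less than (r − 1) m ^ (k + 1).  A 2-regular sequence with
-- gaps in [X, 2X] is measured at the level where m ^ k ≤ 2X < m ^ (k + 1), which gives
-- length ≤ 2 (r − 1)! m.  For a strictly convex sequence the gaps below any threshold form
-- a contiguous run, so fewer than (r − 1) m gaps lie in each band [m ^ k, m ^ (k + 1)) and
-- fewer than m gaps exceed m ^ (r − 1); hence length ≤ r! m.  Raising to the r-th power
-- turns m ^ r into N.

open import Defs
open import Data.Nat using (ℕ; zero; suc; _+_; _*_; _∸_; _^_; _≤_; _<_; _>_; _!; z≤n; s≤s; _<?_; NonZero)
open import Data.Nat.Properties
open import Data.Nat.DivMod
open import Data.Nat.Divisibility using (∣-refl)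
open import Data.Nat.ListAction using (sum)
open import Data.Nat.Tactic.RingSolver using (solve-∀)
open import Data.Fin using (Fin; toℕ; fromℕ<)
open import Data.Fin.Properties using (toℕ-fromℕ<; toℕ-injective; toℕ<n; pigeonhole; ¬∀⟶∃¬; any?)
import Data.Fin.Properties as Fin
open import Data.List using (List; []; _∷_; length; filter)
open import Data.List.Properties using (filter-accept; filter-reject; filter-all; filter-none)
open import Data.List.Membership.Propositional using (_∈_)
open import Data.List.Relation.Unary.Any using (here; there)
open import Data.List.Relation.Unary.All as All using (All; []; _∷_)
open import Data.List.Relation.Unary.Linked as Linked using (Linked; [-]; _∷_)
open import Data.List.Relation.Unary.Linked.Properties using (Linked⇒All)
open import Data.List.Relation.Binary.Sublist.Propositional using (_⊆_; _∷_; _∷ʳ_; ⊆-refl; minimum)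
open import Data.List.Relation.Binary.Sublist.Propositional.Properties
  using (All-resp-⊆; filter-⊆; filter⁺; length-mono-≤)
open import Data.Product as Product using (_×_; _,_; proj₁; proj₂; ∃-syntax; ∃₂)
open import Data.Sum using (_⊎_; inj₁; inj₂)
open import Function using (_∘_; flip)
open import Relation.Binary using (Rel; Transitive)
open import Relation.Nullary using (¬_; yes; no; contradiction)
open import Relation.Binary.PropositionalEquality
open import Algebra.Properties.CommutativeSemigroup *-commutativeSemigroup using (interchange)

span : List ℕ → ℕ
span xs = sum (diffs xs)

suc-length-diffs : ∀ x xs → suc (length (diffs (x ∷ xs))) ≡ length (x ∷ xs)
suc-length-diffs x []       = refl
suc-length-diffs x (y ∷ xs) = cong suc (suc-length-diffs y xs)

diffs-positive : ∀ {xs} → Increasing xs → All (0 <_) (diffs xs)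
diffs-positive Linked.[]  = []
diffs-positive [-]         = []
diffs-positive (x<y ∷ inc) = m<n⇒0<n∸m x<y ∷ diffs-positive inc

head+span∈ : ∀ {x xs} → Increasing (x ∷ xs) → x + span (x ∷ xs) ∈ x ∷ xs
head+span∈ {x} [-]                   = here (+-identityʳ x)
head+span∈ {x} {y ∷ xs} (x<y ∷ inc) = there (subst (_∈ y ∷ xs) (sym shift) (head+span∈ inc))
  where
    shift : x + span (x ∷ y ∷ xs) ≡ y + span (y ∷ xs)
    shift = trans (sym (+-assoc x (y ∸ x) _)) (cong (_+ span (y ∷ xs)) (m+[n∸m]≡n (<⇒≤ x<y)))

span< : ∀ {N x xs} → Increasing (x ∷ xs) → All (λ a → 1 ≤ a × a ≤ N) (x ∷ xs) → span (x ∷ xs) < N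
span< inc bounded@((1≤x , _) ∷ _) =
  ≤-trans (+-monoˡ-≤ _ 1≤x) (proj₂ (All.lookup bounded (head+span∈ inc)))

length*≤sum : ∀ {X} ds → All (X ≤_) ds → length ds * X ≤ sum ds
length*≤sum []       []           = z≤n
length*≤sum (d ∷ ds) (X≤d ∷ X≤ds) = +-mono-≤ X≤d (length*≤sum ds X≤ds)

length≤-of-span< : ∀ {X B} xs → All (X ≤_) (diffs xs) → span xs < B * X → length xs ≤ B
length≤-of-span< []                 _    _  = z≤n
length≤-of-span< {X} {B} (x ∷ xs) X≤ds lt =
  subst (_≤ B) (suc-length-diffs x xs)
    (*-cancelʳ-< X _ B (≤-<-trans (length*≤sum (diffs (x ∷ xs)) X≤ds) lt))

Linked-head : ∀ {ℓ} {R : Rel ℕ ℓ} → Transitive R → ∀ {d ds} → Linked R (d ∷ ds) → All (R d) ds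
Linked-head trans [-]          = []
Linked-head trans (Rde ∷ rest) = Linked⇒All trans Rde rest

below : ℕ → List ℕ → List ℕ
below t = filter (_<? t)

below-none : ∀ {t ds} → All (t ≤_) ds → below t ds ≡ []
below-none t≤ds = filter-none (_<? _) (All.map ≤⇒≯ t≤ds)

length-below-mono : ∀ t {ys zs} → ys ⊆ zs → length (below t ys) ≤ length (below t zs)
length-below-mono t sub = length-mono-≤ (filter⁺ (_<? t) (_<? t) (λ { refl p → p }) sub)

length*≤sum+below : ∀ a ds → length ds * a ≤ sum ds + length (below a ds) * a
length*≤sum+below a []       = z≤n
length*≤sum+below a (d ∷ ds) with d <? a
... | yes d<a = begin
  a + length ds * a                             ≤⟨ +-monoʳ-≤ a (length*≤sum+below a ds) ⟩
  a + (sum ds + length (below a ds) * a)        ≤⟨ m≤n+m _ d ⟩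
  d + (a + (sum ds + length (below a ds) * a))  ≡⟨ shuffle d a (sum ds) _ ⟩
  d + sum ds + (a + length (below a ds) * a)    ≡⟨ cong (λ zs → d + sum ds + length zs * a)
                                                        (sym (filter-accept (_<? a) d<a)) ⟩
  sum (d ∷ ds) + length (below a (d ∷ ds)) * a  ∎
  where
    open ≤-Reasoning
    shuffle : ∀ d a s t → d + (a + (s + t)) ≡ d + s + (a + t)
    shuffle = solve-∀
... | no d≮a = begin
  a + length ds * a                             ≤⟨ +-mono-≤ (≮⇒≥ d≮a) (length*≤sum+below a ds) ⟩
  d + (sum ds + length (below a ds) * a)        ≡⟨ sym (+-assoc d (sum ds) _) ⟩
  d + sum ds + length (below a ds) * a          ≡⟨ cong (λ zs → d + sum ds + length zs * a)
                                                        (sym (filter-reject (_<? a) d≮a)) ⟩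
  sum (d ∷ ds) + length (below a (d ∷ ds)) * a  ∎
  where open ≤-Reasoning

BelowRun : ℕ → List ℕ → List ℕ → Set
BelowRun t xs ys =
  ys ⊆ xs × Increasing ys × All (_< t) (diffs ys) × span ys ≡ sum (below t (diffs xs))

prefix-run : ∀ t {x xs} → Increasing (x ∷ xs) → Linked _<_ (diffs (x ∷ xs)) →
             ∃[ ys ] BelowRun t (x ∷ xs) (x ∷ ys)
prefix-run t [-] _ = [] , ⊆-refl , [-] , [] , refl
prefix-run t {x} {y ∷ xs} (x<y ∷ inc) convex with y ∸ x <? t
... | yes small =
  let ys , sub , inc′ , smalls , eq = prefix-run t inc (Linked.tail convex)
  in y ∷ ys , refl ∷ sub , x<y ∷ inc′ , small ∷ smalls ,
     trans (cong (y ∸ x +_) eq) (cong sum (sym (filter-accept (_<? t) small)))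
... | no large =
  [] , refl ∷ minimum _ , [-] , [] ,
  cong sum (sym (trans (filter-reject (_<? t) large) (below-none later-large)))
  where
    later-large : All (t ≤_) (diffs (y ∷ xs))
    later-large = All.map (λ gap< → ≤-trans (≮⇒≥ large) (<⇒≤ gap<)) (Linked-head <-trans convex)

suffix-run : ∀ t {x xs} → Increasing (x ∷ xs) → Linked _>_ (diffs (x ∷ xs)) →
             ∃₂ λ y ys → BelowRun t (x ∷ xs) (y ∷ ys)
suffix-run t {x} [-] _ = x , [] , ⊆-refl , [-] , [] , refl
suffix-run t {x} {y ∷ xs} inc@(_ ∷ inc′) concave with y ∸ x <? t
... | yes small = x , y ∷ xs , ⊆-refl , inc , all-small , cong sum (sym (filter-all (_<? t) all-small))
  where
    all-small : All (_< t) (diffs (x ∷ y ∷ xs))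
    all-small = small ∷ All.map (λ gap< → <-trans gap< small) (Linked-head (flip <-trans) concave)
... | no large =
  let y′ , ys , sub , inc″ , smalls , eq = suffix-run t inc′ (Linked.tail concave)
  in y′ , ys , x ∷ʳ sub , inc″ , smalls ,
     trans eq (cong sum (sym (filter-reject (_<? t) large)))

below-run : ∀ t {x xs} → StrictlyConvex (x ∷ xs) → ∃₂ λ y ys → BelowRun t (x ∷ xs) (y ∷ ys)
below-run t (inc , inj₁ convex)  = let ys , run = prefix-run t inc convex in _ , ys , run
below-run t (inc , inj₂ concave) = suffix-run t inc concave

m<[1+m/n]*n : ∀ m n .{{_ : NonZero n}} → m < suc (m / n) * n
m<[1+m/n]*n m n = begin-strict
  m                   ≡⟨ m≡m%n+[m/n]*n m n ⟩
  m % n + m / n * n   <⟨ +-monoˡ-< _ (m%n<n m n) ⟩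
  n + m / n * n       ∎
  where open ≤-Reasoning

suc-/-stable : ∀ n u → u % suc n < n → suc u / suc n ≡ u / suc n
suc-/-stable (suc n) u u%<n = begin
  suc u / suc (suc n)                    ≡⟨ /-congˡ (+-comm 1 u) ⟩
  (u + 1) / suc (suc n)                  ≡⟨ +-distrib-/ u 1 (s≤s (subst (_≤ suc n) (+-comm 1 _) u%<n)) ⟩
  u / suc (suc n) + 1 / suc (suc n)      ≡⟨ cong (u / suc (suc n) +_) (m<n⇒m/n≡0 {1} {suc (suc n)} (s≤s (s≤s z≤n))) ⟩
  u / suc (suc n) + 0                    ≡⟨ +-identityʳ _ ⟩
  u / suc (suc n)                        ∎
  where open ≡-Reasoning

/-step : ∀ {p x y} .{{_ : NonZero p}} → x ≤ y → y ≤ x + p → y / p ≡ x / p ⊎ y / p ≡ suc (x / p)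
/-step {p} {x} {y} x≤y y≤x+p with m≤n⇒m<n∨m≡n (/-monoˡ-≤ p x≤y)
... | inj₂ same  = inj₁ (sym same)
... | inj₁ later = inj₂ (≤-antisym (≤-trans (/-monoˡ-≤ p y≤x+p) (≤-reflexive next-block)) later)
  where
    next-block : (x + p) / p ≡ suc (x / p)
    next-block = trans (+-distrib-/-∣ʳ x ∣-refl) (trans (cong (x / p +_) (n/n≡1 p)) (+-comm _ 1))

-- Blocks have length p; colour j groups blocks b into windows by (b + j) / (n + 1).  An element
-- is open for j when its block is not the last one of its window.
module Windows (n p : ℕ) .{{_ : NonZero p}} where

  block : ℕ → ℕ
  block x = x / p

  window : ℕ → ℕ → ℕ
  window j x = (block x + j) / suc n

  Open : ℕ → ℕ → Set
  Open j x = (block x + j) % suc n < n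

  window-stable : ∀ {j x y} → Open j x → x ≤ y → y ≤ x + p → window j y ≡ window j x
  window-stable {j} {x} x-open x≤y y≤x+p with /-step x≤y y≤x+p
  ... | inj₁ same = cong (λ b → (b + j) / suc n) same
  ... | inj₂ next = trans (cong (λ b → (b + j) / suc n) next) (suc-/-stable n (x / p + j) x-open)

  window-diameter : ∀ {j x y} → Open j y → window j x ≡ window j y → y < x + n * p
  window-diameter {j} {x} {y} y-open same = begin-strict
    y                    <⟨ m<[1+m/n]*n y p ⟩
    suc (y / p) * p      ≤⟨ *-monoˡ-≤ p block-bound ⟩
    (n + x / p) * p      ≡⟨ *-distribʳ-+ p n (x / p) ⟩
    n * p + x / p * p    ≤⟨ +-monoʳ-≤ (n * p) (m/n*n≤m x p) ⟩
    n * p + x            ≡⟨ +-comm (n * p) x ⟩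
    x + n * p            ∎
    where
      open ≤-Reasoning
      block-bound : suc (y / p) ≤ n + x / p
      block-bound = +-cancelʳ-≤ j _ _ (begin
        suc (y / p + j)                                 ≡⟨ cong suc (m≡m%n+[m/n]*n (y / p + j) (suc n)) ⟩
        suc ((y / p + j) % suc n + window j y * suc n)  ≤⟨ +-monoˡ-≤ _ y-open ⟩
        n + window j y * suc n                          ≡⟨ cong (λ w → n + w * suc n) (sym same) ⟩
        n + window j x * suc n                          ≤⟨ +-monoʳ-≤ n (m/n*n≤m (x / p + j) (suc n)) ⟩
        n + (x / p + j)                                 ≡⟨ sym (+-assoc n (x / p) j) ⟩
        n + x / p + j                                   ∎)

  window-constant : ∀ {j x xs} → Increasing (x ∷ xs) → All (Open j) (x ∷ xs) →
                    All (_≤ p) (diffs (x ∷ xs)) → All (λ z → window j z ≡ window j x) (x ∷ xs)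
  window-constant [-] _ _ = refl ∷ []
  window-constant {j} {x} {y ∷ xs} (x<y ∷ inc) (x-open ∷ opens) (gap ∷ gaps) =
    refl ∷ All.map (λ e → trans e step) (window-constant inc opens gaps)
    where
      step : window j y ≡ window j x
      step = window-stable x-open (<⇒≤ x<y) (≤-trans (m≤n+m∸n y x) (+-monoʳ-≤ x gap))

  span<-of-gaps≤ : ∀ {j x xs} → Increasing (x ∷ xs) → All (Open j) (x ∷ xs) →
                   All (_≤ p) (diffs (x ∷ xs)) → span (x ∷ xs) < n * p
  span<-of-gaps≤ {x = x} inc opens gaps =
    +-cancelˡ-< x _ _ (window-diameter (All.lookup opens last∈)
                                       (sym (All.lookup (window-constant inc opens gaps) last∈)))
    where last∈ = head+span∈ inc

forbidden : ∀ n → ℕ → Fin (suc n)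
forbidden n b = fromℕ< (s≤s (m∸n≤m n (b % suc n)))

%≡n⇒≡forbidden : ∀ n b j → j ≤ n → (b + j) % suc n ≡ n → j ≡ n ∸ b % suc n
%≡n⇒≡forbidden n b j j≤n last = trans (sym (m+n∸m≡n a j)) (cong (_∸ a) (no-wrap ((a + j) / suc n) decomposition))
  where
    a = b % suc n
    a≤n : a ≤ n
    a≤n = ≤-pred (m%n<n b (suc n))
    decomposition : a + j ≡ n + (a + j) / suc n * suc n
    decomposition = begin
      a + j                                        ≡⟨ m≡m%n+[m/n]*n (a + j) (suc n) ⟩
      (a + j) % suc n + (a + j) / suc n * suc n    ≡⟨ cong (_+ (a + j) / suc n * suc n) reduced ⟩
      n + (a + j) / suc n * suc n                  ∎
      where
        open ≡-Reasoning
        reduced : (a + j) % suc n ≡ n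
        reduced = trans (cong (λ j′ → (a + j′) % suc n) (sym (m≤n⇒m%n≡m j≤n)))
                        (trans (sym (%-distribˡ-+ b j (suc n))) last)
    -- a + j ≤ 2n, so the quotient by n + 1 cannot be positive.
    no-wrap : ∀ q → a + j ≡ n + q * suc n → a + j ≡ n
    no-wrap zero    eq = trans eq (+-identityʳ n)
    no-wrap (suc q) eq = contradiction (+-mono-≤ a≤n j≤n) (<⇒≱ (begin-strict
      n + n                  <⟨ +-monoʳ-< n (n<1+n n) ⟩
      n + suc n              ≤⟨ +-monoʳ-≤ n (m≤m+n (suc n) (q * suc n)) ⟩
      n + suc q * suc n      ≡⟨ sym eq ⟩
      a + j                  ∎))
      where open ≤-Reasoning

open-unless-forbidden : ∀ n b (j : Fin (suc n)) → j ≢ forbidden n b → (b + toℕ j) % suc n < n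
open-unless-forbidden n b j j≢forbidden = ≤∧≢⇒< (≤-pred (m%n<n (b + toℕ j) (suc n))) λ last →
  j≢forbidden (toℕ-injective (trans (%≡n⇒≡forbidden n b (toℕ j) (≤-pred (toℕ<n j)) last)
                                    (sym (toℕ-fromℕ< _))))

misses-value : ∀ {n} (f : Fin n → Fin (suc n)) → ∃[ j ] (∀ i → j ≢ f i)
misses-value {n} f =
  Product.map₂ (λ ¬hit i j≡fi → ¬hit (i , sym j≡fi))
    (¬∀⟶∃¬ (suc n) (λ j → ∃[ i ] f i ≡ j) (λ j → any? (λ i → f i Fin.≟ j)) not-surjective)
  where
    not-surjective : ¬ (∀ j → ∃[ i ] f i ≡ j)
    not-surjective hit =
      let a , b , a<b , same = pigeonhole (n<1+n n) (proj₁ ∘ hit)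
      in Fin.<⇒≢ a<b (trans (sym (proj₂ (hit a))) (trans (cong f same) (proj₂ (hit b))))

module Colouring (n m : ℕ) .{{_ : NonZero m}} where

  scale : ℕ → ℕ
  scale k = m ^ suc k

  module Level (k : ℕ) = Windows n (scale k) {{m^n≢0 m (suc k)}}

  forbidden-colours : ℕ → Fin n → Fin (suc n)
  forbidden-colours x k = forbidden n (Level.block (toℕ k) x)

  colour : ℕ → Fin (suc n)
  colour x = proj₁ (misses-value (forbidden-colours x))

  colour-open : ∀ x {k} → k < n → Level.Open k (toℕ (colour x)) x
  colour-open x k<n =
    subst (λ k → Level.Open k (toℕ (colour x)) x) (toℕ-fromℕ< k<n)
      (open-unless-forbidden n (Level.block (toℕ (fromℕ< k<n)) x) (colour x)
        (proj₂ (misses-value (forbidden-colours x)) (fromℕ< k<n)))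

power-bracket : ∀ m {Y} q → 1 ≤ Y → m ^ q ≤ Y ⊎ ∃[ k ] (k < q × m ^ k ≤ Y × Y < m ^ suc k)
power-bracket m zero 1≤Y = inj₁ 1≤Y
power-bracket m {Y} (suc q) 1≤Y with power-bracket m q 1≤Y
... | inj₂ (k , k<q , lo , hi) = inj₂ (k , m<n⇒m<1+n k<q , lo , hi)
... | inj₁ lo with Y <? m ^ suc q
...   | yes hi = inj₂ (q , n<1+n q , lo , hi)
...   | no ¬hi = inj₁ (≮⇒≥ ¬hi)

n≤n! : ∀ n → n ≤ n !
n≤n! zero    = z≤n
n≤n! (suc n) = m≤m*n (suc n) (n !) {{n !≢0}}

factorial-bound : ∀ n m → m + n * (n * m) ≤ suc n ! * m
factorial-bound n m = begin
  m + n * (n * m)   ≡⟨ regroup n m ⟩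
  (1 + n * n) * m   ≤⟨ *-monoˡ-≤ m (+-mono-≤ (1≤n! n) (*-monoʳ-≤ n (n≤n! n))) ⟩
  suc n ! * m       ∎
  where
    open ≤-Reasoning
    regroup : ∀ n m → m + n * (n * m) ≡ (1 + n * n) * m
    regroup = solve-∀

^-distribʳ-* : ∀ a b e → (a * b) ^ e ≡ a ^ e * b ^ e
^-distribʳ-* a b zero    = refl
^-distribʳ-* a b (suc e) = trans (cong (a * b *_) (^-distribʳ-* a b e)) (interchange a b (a ^ e) (b ^ e))

^-bound : ∀ {ℓ} B m e → ℓ ≤ B * m → ℓ ^ e ≤ B ^ e * m ^ e
^-bound B m e ℓ≤Bm = ≤-trans (^-monoˡ-≤ e ℓ≤Bm) (≤-reflexive (^-distribʳ-* B m e))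

module ColourClasses (n M : ℕ) where

  m : ℕ
  m = suc M

  N : ℕ
  N = m ^ suc n

  open Colouring n m public

  M≤N : M ≤ N
  M≤N = ≤-trans (n≤1+n M) (m≤m*n m (m ^ n) {{m^n≢0 m n}})

  in-range : ∀ {i xs} → SubPart N colour i xs → All (λ a → 1 ≤ a × a ≤ N) xs
  in-range = All.map λ (1≤a , a≤N , _) → 1≤a , a≤N

  class-open : ∀ {i xs} → SubPart N colour i xs → ∀ {k} → k < n → All (Level.Open k (toℕ i)) xs
  class-open sp {k} k<n =
    All.map (λ {x} (_ , _ , colour≡i) → subst (λ c → Level.Open k (toℕ c) x) colour≡i (colour-open x k<n)) sp

  regular-length : ∀ {i} xs → SubPart N colour i xs → Regular 2 xs → length xs ≤ 2 * n ! * m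
  regular-length [] _ _ = z≤n
  regular-length (x ∷ xs) sp (inc , X , 1≤X , gaps) with power-bracket m n (≤-trans 1≤X (m≤m+n X _))
  ... | inj₁ mⁿ≤2X =
    ≤-trans (length≤-of-span< (x ∷ xs) (All.map proj₁ gaps) coarse)
            (≤-trans (≤-reflexive (*-comm m 2)) (*-monoˡ-≤ m (*-monoʳ-≤ 2 (1≤n! n))))
    where
      coarse : span (x ∷ xs) < m * 2 * X
      coarse = begin-strict
        span (x ∷ xs) <⟨ span< inc (in-range sp) ⟩
        m * m ^ n     ≤⟨ *-monoʳ-≤ m mⁿ≤2X ⟩
        m * (2 * X)   ≡⟨ sym (*-assoc m 2 X) ⟩
        m * 2 * X     ∎
        where open ≤-Reasoning
  ... | inj₂ (k , k<n , mᵏ≤2X , 2X<mᵏ⁺¹) =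
    ≤-trans (length≤-of-span< (x ∷ xs) (All.map proj₁ gaps) fine)
            (≤-trans (≤-reflexive (sym (*-assoc 2 n m))) (*-monoˡ-≤ m (*-monoʳ-≤ 2 (n≤n! n))))
    where
      gaps≤scale : All (_≤ scale k) (diffs (x ∷ xs))
      gaps≤scale = All.map (λ (_ , d≤2X) → <⇒≤ (≤-<-trans d≤2X 2X<mᵏ⁺¹)) gaps
      regroup : ∀ n m X → n * (m * (2 * X)) ≡ 2 * (n * m) * X
      regroup = solve-∀
      fine : span (x ∷ xs) < 2 * (n * m) * X
      fine = begin-strict
        span (x ∷ xs)       <⟨ Level.span<-of-gaps≤ k inc (class-open sp k<n) gaps≤scale ⟩
        n * (m * m ^ k)     ≤⟨ *-monoʳ-≤ n (*-monoʳ-≤ m mᵏ≤2X) ⟩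
        n * (m * (2 * X))   ≡⟨ regroup n m X ⟩
        2 * (n * m) * X     ∎
        where open ≤-Reasoning

  convex-length : ∀ {i} xs → SubPart N colour i xs → StrictlyConvex xs → length xs ≤ suc n ! * m
  convex-length [] _ _ = z≤n
  convex-length (x ∷ xs) sp convex =
    ≤-trans (subst (_≤ m + n * (n * m)) (suc-length-diffs x xs) few-gaps) (factorial-bound n m)
    where
      gaps = diffs (x ∷ xs)
      inc = proj₁ convex

      sum-below< : ∀ {q} → q < n → sum (below (scale q) gaps) < n * scale q
      sum-below< {q} q<n =
        let _ , _ , sub , inc′ , small , eq = below-run (scale q) convex
        in subst (_< n * scale q) eq
             (Level.span<-of-gaps≤ q inc′ (All-resp-⊆ sub (class-open sp q<n)) (All.map <⇒≤ small))

      count-below : ∀ q → q ≤ n → length (below (m ^ q) gaps) ≤ q * (n * m)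
      count-below zero    _   = ≤-reflexive (cong length (below-none (diffs-positive inc)))
      count-below (suc q) q<n = ≤-trans (<⇒≤ band) (+-monoʳ-≤ (n * m) (count-below q (<⇒≤ q<n)))
        where
          a = m ^ q
          band : length (below (scale q) gaps) < n * m + length (below a gaps)
          band = *-cancelʳ-< a _ _ (begin-strict
            length (below (scale q) gaps) * a
              ≤⟨ length*≤sum+below a (below (scale q) gaps) ⟩
            sum (below (scale q) gaps) + length (below a (below (scale q) gaps)) * a
              ≤⟨ +-monoʳ-≤ _ (*-monoˡ-≤ a (length-below-mono a (filter-⊆ (_<? scale q) gaps))) ⟩
            sum (below (scale q) gaps) + length (below a gaps) * a
              <⟨ +-monoˡ-< _ (sum-below< q<n) ⟩
            n * (m * a) + length (below a gaps) * a
              ≡⟨ cong (_+ length (below a gaps) * a) (sym (*-assoc n m a)) ⟩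
            n * m * a + length (below a gaps) * a
              ≡⟨ sym (*-distribʳ-+ a (n * m) _) ⟩
            (n * m + length (below a gaps)) * a ∎)
            where open ≤-Reasoning

      few-gaps : length gaps < m + n * (n * m)
      few-gaps = *-cancelʳ-< (m ^ n) _ _ (begin-strict
        length gaps * m ^ n
          ≤⟨ length*≤sum+below (m ^ n) gaps ⟩
        span (x ∷ xs) + length (below (m ^ n) gaps) * m ^ n
          <⟨ +-monoˡ-< _ (span< inc (in-range sp)) ⟩
        m * m ^ n + length (below (m ^ n) gaps) * m ^ n
          ≤⟨ +-monoʳ-≤ (m * m ^ n) (*-monoˡ-≤ (m ^ n) (count-below n ≤-refl)) ⟩
        m * m ^ n + n * (n * m) * m ^ n
          ≡⟨ sym (*-distribʳ-+ (m ^ n) m _) ⟩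
        (m + n * (n * m)) * m ^ n ∎)
        where open ≤-Reasoning

theorem5 : (r : ℕ) → 1 ≤ r → (M : ℕ) →
    ∃[ N ] (M ≤ N × ∃[ c ] (
      ((i : Fin r) (xs : List ℕ) → SubPart N c i xs → Regular 2 xs →
         length xs ^ r ≤ (2 * ((r ∸ 1) !)) ^ r * N)
      × ((i : Fin r) (xs : List ℕ) → SubPart N c i xs → StrictlyConvex xs →
         length xs ^ r ≤ (r !) ^ r * N)))
theorem5 (suc n) _ M =
  N , M≤N , colour ,
  (λ _ xs sp regular → ^-bound (2 * n !) m (suc n) (regular-length xs sp regular)) ,
  (λ _ xs sp convex → ^-bound (suc n !) m (suc n) (convex-length xs sp convex))
  where open ColourClasses n M
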